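{- Let $\alpha\in\{0,1\}^*$ be arbitrary. Every idempotent polymorphism of $\mathcal{P}_{10\alpha01}$ is a projection.
   Context: For $\beta\in\{0,1\}^n$, $\mathcal{P}_\beta$ is the undirected graph on vertices $1,\dots,n$ with edges $\{i,i+1\}$ for $i<n$ and a loop at $i$ iff the $i$-th letter of $\beta$ is $1$. A $k$-ary polymorphism is a map $f:[n]^k\to[n]$ such that applying $f$ coordinatewise to $k$ edges gives an edge; it is idempotent if $f(x,\dots,x)=x$; it is a projection if $f(x_1,\dots,x_k)=x_i$ for some fixed $i$. -}

module Defs where

open import Data.Bool using (Bool; true; false; T)
open import Data.List using (List; []; length; lookup; _∷_; _++_)
open import Data.Fin using (Fin; toℕ)
open import Data.Nat using (ℕ; suc)
open import Data.Product using (∃; _×_)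
open import Data.Sum using (_⊎_)
open import Relation.Binary.PropositionalEquality using (_≡_)

-- Vertices of P_β: Fin (length β), vertex i (0-based) corresponds to i+1.
Vertex : List Bool → Set
Vertex β = Fin (length β)

Edge : (β : List Bool) → Vertex β → Vertex β → Set
Edge β i j = (suc (toℕ i) ≡ toℕ j) ⊎ (suc (toℕ j) ≡ toℕ i) ⊎ ((i ≡ j) × T (lookup β i))

Op : ℕ → List Bool → Set
Op k β = (Fin k → Vertex β) → Vertex β

IsPolymorphism : (k : ℕ) (β : List Bool) → Op k β → Set
IsPolymorphism k β f =
  (x y : Fin k → Vertex β) → ((m : Fin k) → Edge β (x m) (y m)) → Edge β (f x) (f y)

IsIdempotent : (k : ℕ) (β : List Bool) → Op k β → Set
IsIdempotent k β f = (v : Vertex β) → f (λ _ → v) ≡ v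

IsProjection : (k : ℕ) (β : List Bool) → Op k β → Set
IsProjection k β f = ∃ λ (m : Fin k) → (x : Fin k → Vertex β) → f x ≡ x m

word : List Bool → List Bool
word α = true ∷ false ∷ (α ++ (false ∷ true ∷ []))

-- A polymorphism f maps coordinatewise adjacent tuples to adjacent vertices, so its value
-- moves by at most one when all entries take one step; the loops at both ends of the path let
-- entries stand still there, and the missing loops at the second and penultimate vertex forbid
-- f itself to stand still at those values.
--
-- On two-level tuples, whose entries are j or j + 1 according to a pattern σ ⊆ {1, ..., k},
-- comparing the bottom level with the top one shows that f rises by exactly one per level, so
-- it takes the value j + c(σ) with c(σ) ∈ {0, 1}. The patterns with c(σ) = 1 include the full
-- one but not the empty one, and a three-level staircase tuple shows that when such a pattern
-- is a disjoint union, one of the two parts again has c = 1. Hence they are exactly the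
-- patterns containing one coordinate m.
--
-- For arbitrary tuples one inducts on the width of a window [a, a + s] containing all entries:
-- moving each entry one step towards a threshold gives an adjacent tuple in a narrower window,
-- and two such moves whose m-th entries are x_m ± 1 pin f x to x_m. When x_m is at an edge of
-- the window, the whole window is shifted to the end of the path instead, where the missing
-- loops decide.

module Submission where

open import Data.Bool using (Bool; true; false; not; T; _∨_)
open import Data.Bool.Properties using (not-involutive)
open import Data.Empty using (⊥; ⊥-elim)
open import Data.Fin using (Fin; toℕ; fromℕ<) renaming (zero to fzero; suc to fsuc)
open import Data.Fin.Properties using (toℕ-injective; toℕ<n; toℕ-fromℕ<)
open import Data.List using (List; []; _∷_; _++_; length; lookup)
open import Data.List.Properties using (length-++)
open import Data.Nat
  using (ℕ; zero; suc; pred; _+_; _∸_; _⊓_; _≤_; _<_; z≤n; s≤s; z<s; >-nonZero; _<ᵇ_; _≡ᵇ_)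
open import Data.Nat.Properties
open import Algebra.Properties.CommutativeSemigroup +-commutativeSemigroup using (xy∙z≈xz∙y)
open import Data.Product using (_×_; _,_; proj₁; proj₂; ∃)
open import Data.Sum using (_⊎_; inj₁; inj₂)
open import Data.Unit using (tt)
open import Function using (_∘_)
open import Relation.Binary.PropositionalEquality
open import Relation.Nullary using (¬_; yes; no)
open import Relation.Nullary.Decidable using (⌊_⌋)

open import Defs

Close : ℕ → ℕ → Set
Close a b = a ≤ suc b × b ≤ suc a

toward : ℕ → ℕ → ℕ
toward c v with v <? c
... | yes _ = suc v
... | no  _ = pred v

toward-below : ∀ {c v} → v < c → toward c v ≡ suc v
toward-below {c} {v} v<c with v <? c
... | yes _   = refl
... | no  v≮c = ⊥-elim (v≮c v<c)

toward-above : ∀ {c v} → c ≤ v → toward c v ≡ pred v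
toward-above {c} {v} c≤v with v <? c
... | yes v<c = ⊥-elim (<⇒≱ v<c c≤v)
... | no  _   = refl

-- Only the edges of P_β present for every α: the path and the loops at its two ends.
module Path (top : ℕ) where

  infix 4 _~_
  data _~_ : ℕ → ℕ → Set where
    up       : ∀ {v} → v ~ suc v
    down     : ∀ {v} → suc v ~ v
    loop-0   : 0 ~ 0
    loop-top : top ~ top

  ~-sym : ∀ {a b} → a ~ b → b ~ a
  ~-sym up       = down
  ~-sym down     = up
  ~-sym loop-0   = loop-0
  ~-sym loop-top = loop-top

  ~-pred : ∀ v → v ~ pred v
  ~-pred zero    = loop-0
  ~-pred (suc v) = down

  up-⊓ : ∀ v → v ⊓ top ~ suc v ⊓ top
  up-⊓ v with v <? top
  ... | yes v<top = subst₂ _~_ (sym (m≤n⇒m⊓n≡m (<⇒≤ v<top))) (sym (m≤n⇒m⊓n≡m v<top)) up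
  ... | no  v≮top = subst₂ _~_ (sym (m≥n⇒m⊓n≡n top≤v)) (sym (m≥n⇒m⊓n≡n (m≤n⇒m≤1+n top≤v))) loop-top
    where top≤v = ≮⇒≥ v≮top

  ~-⊓ : ∀ {a b} → a ~ b → a ⊓ top ~ b ⊓ top
  ~-⊓ (up {v})   = up-⊓ v
  ~-⊓ (down {v}) = ~-sym (up-⊓ v)
  ~-⊓ loop-0     = loop-0
  ~-⊓ loop-top   = subst₂ _~_ (sym (⊓-idem top)) (sym (⊓-idem top)) loop-top

  ~-toward : ∀ c v → v ~ toward c v
  ~-toward c v with v <? c
  ... | yes _ = up
  ... | no  _ = ~-pred v

Pattern : ℕ → Set
Pattern k = Fin k → Bool

bit : Bool → ℕ
bit false = 0
bit true  = 1

bit-injective : ∀ {b c} → bit b ≡ bit c → b ≡ c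
bit-injective {false} {false} _ = refl
bit-injective {true}  {true}  _ = refl

module _ {k : ℕ} where

  Disjoint : Pattern k → Pattern k → Set
  Disjoint σ τ = ∀ i → T (σ i) → T (τ i) → ⊥

  _∪_ : Pattern k → Pattern k → Pattern k
  (σ ∪ τ) i = σ i ∨ τ i

  single : ℕ → Pattern k
  single q i = toℕ i ≡ᵇ q

  prefix : ℕ → Pattern k
  prefix q i = toℕ i <ᵇ q

  <ᵇ-suc : ∀ n q → (n <ᵇ suc q) ≡ ((n <ᵇ q) ∨ (n ≡ᵇ q))
  <ᵇ-suc zero    zero    = refl
  <ᵇ-suc zero    (suc q) = refl
  <ᵇ-suc (suc n) zero    = refl
  <ᵇ-suc (suc n) (suc q) = <ᵇ-suc n q

  prefix-suc : ∀ q → prefix (suc q) ≗ prefix q ∪ single q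
  prefix-suc q i = <ᵇ-suc (toℕ i) q

  prefix-single-disjoint : ∀ q → Disjoint (prefix q) (single q)
  prefix-single-disjoint q i i<q i≡q =
    <-irrefl (≡ᵇ⇒≡ (toℕ i) q i≡q) (<ᵇ⇒< (toℕ i) q i<q)

  prefix-full : ∀ i → prefix k i ≡ true
  prefix-full i with toℕ i <ᵇ k | <⇒<ᵇ (toℕ<n i)
  ... | true | _ = refl

  single-disjoint : ∀ {m σ} → σ m ≡ false → Disjoint (single (toℕ m)) σ
  single-disjoint {m} {σ} σm≡false i i≡m σi
    rewrite toℕ-injective (≡ᵇ⇒≡ (toℕ i) (toℕ m) i≡m) | σm≡false = σi

  module _ (P : Pattern k → Set) (P-cong : ∀ {σ τ} → σ ≗ τ → P σ → P τ)
           (P-empty : ¬ P (λ _ → false))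
           (P-split : ∀ {σ τ} → Disjoint σ τ → P (σ ∪ τ) → P σ ⊎ P τ) where

    singleton-from-prefix : ∀ q → q ≤ k → P (prefix q) → ∃ λ (m : Fin k) → P (single (toℕ m))
    singleton-from-prefix zero    _   P-prefix = ⊥-elim (P-empty P-prefix)
    singleton-from-prefix (suc q) q<k P-prefix
      with P-split (prefix-single-disjoint q) (P-cong (prefix-suc q) P-prefix)
    ... | inj₁ P-prefix′ = singleton-from-prefix q (<⇒≤ q<k) P-prefix′
    ... | inj₂ P-single  =
      fromℕ< q<k , P-cong (λ i → cong (toℕ i ≡ᵇ_) (sym (toℕ-fromℕ< q<k))) P-single

    singleton-from-full : P (λ _ → true) → ∃ λ (m : Fin k) → P (single (toℕ m))
    singleton-from-full P-full =
      singleton-from-prefix k ≤-refl (P-cong (λ i → sym (prefix-full i)) P-full)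

module LoopedEnds
  (β : List Bool) (p : ℕ) (length-β : length β ≡ 4 + p)
  (loop-first     : ∀ u → toℕ u ≡ 0     → T (lookup β u))
  (no-loop-second : ∀ u → toℕ u ≡ 1     → ¬ T (lookup β u))
  (no-loop-penult : ∀ u → toℕ u ≡ 2 + p → ¬ T (lookup β u))
  (loop-last      : ∀ u → toℕ u ≡ 3 + p → T (lookup β u))
  (k : ℕ) (f : Op k β) (poly : IsPolymorphism k β f) (idem : IsIdempotent k β f)
  where

  top top-1 : ℕ
  top   = 3 + p
  top-1 = 2 + p

  open Path top

  0<top : 0 < top
  0<top = z<s

  top-1<top : top-1 < top
  top-1<top = ≤-refl

  ≤top : (u : Vertex β) → toℕ u ≤ top
  ≤top u = ≤-pred (subst (toℕ u <_) length-β (toℕ<n u))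

  vertex : ℕ → Vertex β
  vertex v = fromℕ< (≤-<-trans (m⊓n≤n v top) (subst (top <_) (sym length-β) ≤-refl))

  toℕ-vertex : ∀ v → toℕ (vertex v) ≡ v ⊓ top
  toℕ-vertex v = toℕ-fromℕ< _

  toℕ-vertex-≤ : ∀ {v} → v ≤ top → toℕ (vertex v) ≡ v
  toℕ-vertex-≤ v≤top = trans (toℕ-vertex _) (m≤n⇒m⊓n≡m v≤top)

  NoLoopAt : ℕ → Set
  NoLoopAt w = ∀ u → toℕ u ≡ w → ¬ T (lookup β u)

  edge : ∀ {u v a b} → a ~ b → toℕ u ≡ a → toℕ v ≡ b → Edge β u v
  edge up       eu ev = inj₁ (trans (cong suc eu) (sym ev))
  edge down     eu ev = inj₂ (inj₁ (trans (cong suc ev) (sym eu)))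
  edge {u} loop-0   eu ev = inj₂ (inj₂ (toℕ-injective (trans eu (sym ev)) , loop-first u eu))
  edge {u} loop-top eu ev = inj₂ (inj₂ (toℕ-injective (trans eu (sym ev)) , loop-last u eu))

  edge-close : ∀ {u v} → Edge β u v → Close (toℕ u) (toℕ v)
  edge-close (inj₁ e)                = m<n⇒m≤1+n (≤-reflexive e) , ≤-reflexive (sym e)
  edge-close (inj₂ (inj₁ e))         = ≤-reflexive (sym e) , m<n⇒m≤1+n (≤-reflexive e)
  edge-close (inj₂ (inj₂ (refl , _))) = n≤1+n _ , n≤1+n _

  edge-no-repeat : ∀ {u v w} → NoLoopAt w → Edge β u v → toℕ u ≡ w → toℕ v ≡ w → ⊥
  edge-no-repeat _ (inj₁ e)        eu ev = 1+n≢n (trans (cong suc (sym eu)) (trans e ev))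
  edge-no-repeat _ (inj₂ (inj₁ e)) eu ev = 1+n≢n (trans (cong suc (sym ev)) (trans e eu))
  edge-no-repeat {u} no-loop (inj₂ (inj₂ (refl , loop))) eu _ = no-loop u eu loop

  Tuple : Set
  Tuple = Fin k → Vertex β

  F : Tuple → ℕ
  F x = toℕ (f x)

  F≤top : ∀ x → F x ≤ top
  F≤top x = ≤top (f x)

  F-const : ∀ {v} → v ≤ top → F (λ _ → vertex v) ≡ v
  F-const v≤top = trans (cong toℕ (idem _)) (toℕ-vertex-≤ v≤top)

  Adjacent : Tuple → Tuple → Set
  Adjacent x y = ∀ i → toℕ (x i) ~ toℕ (y i)

  F-edge : ∀ {x y} → Adjacent x y → Edge β (f x) (f y)
  F-edge adj = poly _ _ (λ i → edge (adj i) refl refl)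

  F-close : ∀ {x y} → Adjacent x y → Close (F x) (F y)
  F-close = edge-close ∘ F-edge

  F-no-repeat : ∀ {x y w} → NoLoopAt w → Adjacent x y → F x ≡ w → F y ≡ w → ⊥
  F-no-repeat no-loop = edge-no-repeat no-loop ∘ F-edge

  F-forced-bottom : ∀ {x y} → Adjacent x y → F y ≡ 1 → F x ≤ 1 → F x ≡ 0
  F-forced-bottom adj Fy≡1 Fx≤1 =
    n≤0⇒n≡0 (≤-pred (≤∧≢⇒< Fx≤1 (λ Fx≡1 → F-no-repeat no-loop-second adj Fx≡1 Fy≡1)))

  F-forced-top : ∀ {x y} → Adjacent x y → F y ≡ top-1 → top-1 ≤ F x → F x ≡ top
  F-forced-top {x} adj Fy≡top-1 top-1≤Fx =
    ≤-antisym (F≤top x) (≤∧≢⇒< top-1≤Fx (λ e → F-no-repeat no-loop-penult adj (sym e) Fy≡top-1))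

  -- f is not known to respect pointwise equality of tuples, so statements about its values
  -- quantify over every tuple x ≐ u with prescribed entries u.
  infix 4 _≐_
  _≐_ : Tuple → (Fin k → ℕ) → Set
  x ≐ u = ∀ i → toℕ (x i) ≡ u i

  realise : (Fin k → ℕ) → Tuple
  realise u i = vertex (u i)

  realise-≐ : ∀ {u} → (∀ i → u i ≤ top) → realise u ≐ u
  realise-≐ u≤top i = toℕ-vertex-≤ (u≤top i)

  adjacent : ∀ {x y u w} → x ≐ u → y ≐ w → (∀ i → u i ~ w i) → Adjacent x y
  adjacent x≐u y≐w u~w i = subst₂ _~_ (sym (x≐u i)) (sym (y≐w i)) (u~w i)

  adjacent-sym : ∀ {x y} → Adjacent x y → Adjacent y x
  adjacent-sym adj = ~-sym ∘ adj

  lift : ℕ → Pattern k → Fin k → ℕ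
  lift j σ i = bit (σ i) + j

  level : ℕ → Pattern k → Tuple
  level j σ = realise (lift j σ)

  level-≐ : ∀ {j} σ → j < top → level j σ ≐ lift j σ
  level-≐ {j} σ j<top = realise-≐ (λ i → bit≤ (σ i))
    where
    bit≤ : ∀ b → bit b + j ≤ top
    bit≤ false = <⇒≤ j<top
    bit≤ true  = j<top

  lift-cong : ∀ {j σ τ x} → σ ≗ τ → x ≐ lift j σ → x ≐ lift j τ
  lift-cong {j} σ≗τ x≐ i = trans (x≐ i) (cong (λ b → bit b + j) (σ≗τ i))

  level-adjacent : ∀ {j σ x y} → x ≐ lift j σ → y ≐ lift (suc j) σ → Adjacent x y
  level-adjacent {j} {σ} x≐ y≐ = adjacent x≐ y≐ (λ i → step (σ i))
    where
    step : ∀ b → bit b + j ~ bit b + suc j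
    step false = up
    step true  = up

  complement-adjacent : ∀ {j σ x y} → x ≐ lift j σ → y ≐ lift j (not ∘ σ) → Adjacent x y
  complement-adjacent {j} {σ} x≐ y≐ = adjacent x≐ y≐ (λ i → step (σ i))
    where
    step : ∀ b → bit b + j ~ bit (not b) + j
    step false = up
    step true  = down

  F-bottom-level : ∀ {σ x} → x ≐ lift 0 σ → F x ≤ 1
  F-bottom-level {σ} {x} x≐ = subst (λ c → F x ≤ suc c) (F-const z≤n) (proj₁ (F-close adj))
    where
    step : ∀ b → bit b + 0 ~ 0
    step false = loop-0
    step true  = down
    adj : Adjacent x (λ _ → vertex 0)
    adj = adjacent x≐ (λ _ → toℕ-vertex-≤ z≤n) (λ i → step (σ i))

  F-top-level : ∀ {σ y} → y ≐ lift top-1 σ → top-1 ≤ F y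
  F-top-level {σ} {y} y≐ = ≤-pred (subst (_≤ suc (F y)) (F-const ≤-refl) (proj₂ (F-close adj)))
    where
    step : ∀ b → bit b + top-1 ~ top
    step false = up
    step true  = loop-top
    adj : Adjacent y (λ _ → vertex top)
    adj = adjacent y≐ (λ _ → toℕ-vertex-≤ ≤-refl) (λ i → step (σ i))

  climb : ∀ {σ i j x y} → i < j → j < top → x ≐ lift i σ → y ≐ lift j σ → F y + i ≤ F x + j
  climb {σ} {i} {suc j} {x} {y} i<1+j 1+j<top x≐ y≐ with m≤n⇒m<n∨m≡n (≤-pred i<1+j)
  ... | inj₂ refl = begin
    F y + i          ≤⟨ +-monoˡ-≤ i (proj₂ (F-close (level-adjacent x≐ y≐))) ⟩
    suc (F x + i)    ≡⟨ sym (+-suc (F x) i) ⟩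
    F x + suc i      ∎
    where open ≤-Reasoning
  ... | inj₁ i<j = begin
    F y + i          ≤⟨ +-monoˡ-≤ i (proj₂ (F-close (level-adjacent z≐ y≐))) ⟩
    suc (F z + i)    ≤⟨ s≤s (climb i<j j<top x≐ z≐) ⟩
    suc (F x + j)    ≡⟨ sym (+-suc (F x) j) ⟩
    F x + suc j      ∎
    where
    open ≤-Reasoning
    j<top = <-trans (n<1+n j) 1+j<top
    z = level j σ
    z≐ = level-≐ σ j<top

  top-level-from-0 : ∀ {σ x y} → x ≐ lift 0 σ → y ≐ lift top-1 σ → F x ≡ 0 → F y ≡ top-1
  top-level-from-0 {x = x} {y} x≐ y≐ Fx≡0 = ≤-antisym Fy≤top-1 (F-top-level y≐)
    where
    Fy≤top-1 : F y ≤ top-1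
    Fy≤top-1 = begin
      F y           ≡⟨ sym (+-identityʳ (F y)) ⟩
      F y + 0       ≤⟨ climb z<s top-1<top x≐ y≐ ⟩
      F x + top-1   ≡⟨ cong (_+ top-1) Fx≡0 ⟩
      top-1         ∎
      where open ≤-Reasoning

  bottom-complement : ∀ {σ x x′} → x ≐ lift 0 σ → x′ ≐ lift 0 (not ∘ σ) → F x ≡ 1 → F x′ ≡ 0
  bottom-complement {σ} x≐ x′≐ Fx≡1 =
    F-forced-bottom (adjacent-sym (complement-adjacent {σ = σ} x≐ x′≐)) Fx≡1 (F-bottom-level x′≐)

  top-complement : ∀ {σ y y′} → y ≐ lift top-1 σ → y′ ≐ lift top-1 (not ∘ σ) →
                   F y ≡ top-1 → F y′ ≡ top
  top-complement {σ} y≐ y′≐ Fy≡top-1 =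
    F-forced-top (adjacent-sym (complement-adjacent {σ = σ} y≐ y′≐)) Fy≡top-1 (F-top-level y′≐)

  top-level-from-bottom : ∀ {σ x y} → x ≐ lift 0 σ → y ≐ lift top-1 σ → F y ≡ F x + top-1
  top-level-from-bottom {σ} {x} x≐ y≐ with m≤n⇒m<n∨m≡n (F-bottom-level x≐)
  ... | inj₂ Fx≡1 = trans Fy≡top (cong (_+ top-1) (sym Fx≡1))
    where
    x′≐ = level-≐ (not ∘ σ) 0<top
    y′≐ = level-≐ (not ∘ σ) top-1<top
    Fy≡top = top-complement y′≐ (lift-cong (sym ∘ not-involutive ∘ σ) y≐)
               (top-level-from-0 x′≐ y′≐ (bottom-complement x≐ x′≐ Fx≡1))
  ... | inj₁ (s≤s Fx≤0) = trans (top-level-from-0 x≐ y≐ Fx≡0) (cong (_+ top-1) (sym Fx≡0))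
    where Fx≡0 = n≤0⇒n≡0 Fx≤0

  level-upper : ∀ {σ} j {x} → j < top → x ≐ lift j σ → F x ≤ F (level 0 σ) + j
  level-upper {σ} zero {x} _ x≐ = ≤-reflexive (begin
    F x                    ≡⟨ +-cancelʳ-≡ top-1 _ _ (trans (sym (top-level-from-bottom x≐ y≐))
                                                          (top-level-from-bottom x₀≐ y≐)) ⟩
    F (level 0 σ)          ≡⟨ sym (+-identityʳ _) ⟩
    F (level 0 σ) + 0      ∎)
    where
    open ≡-Reasoning
    x₀≐ = level-≐ σ 0<top
    y≐ = level-≐ σ top-1<top
  level-upper {σ} (suc j) {x} j<top x≐ =
    subst (_≤ _) (+-identityʳ (F x)) (climb z<s j<top (level-≐ σ 0<top) x≐)

  level-lower : ∀ {σ j x} → j < top → x ≐ lift j σ → F (level 0 σ) + j ≤ F x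
  level-lower {σ} {j} {x} j<top x≐ with m≤n⇒m<n∨m≡n (≤-pred j<top)
  ... | inj₂ refl = ≤-reflexive (sym (top-level-from-bottom (level-≐ σ 0<top) x≐))
  ... | inj₁ j<top-1 = +-cancelʳ-≤ top-1 _ _ (begin
    F x₀ + j + top-1        ≡⟨ xy∙z≈xz∙y (F x₀) j top-1 ⟩
    F x₀ + top-1 + j        ≡⟨ cong (_+ j) (sym (top-level-from-bottom x₀≐ y≐)) ⟩
    F (level top-1 σ) + j   ≤⟨ climb j<top-1 top-1<top x≐ y≐ ⟩
    F x + top-1             ∎)
    where
    open ≤-Reasoning
    x₀ = level 0 σ
    x₀≐ = level-≐ σ 0<top
    y≐ = level-≐ σ top-1<top

  level-rigid : ∀ {σ j x} → j < top → x ≐ lift j σ → F x ≡ F (level 0 σ) + j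
  level-rigid j<top x≐ = ≤-antisym (level-upper _ j<top x≐) (level-lower j<top x≐)

  infix 4 _↦_
  _↦_ : Pattern k → Bool → Set
  σ ↦ b = ∀ {j x} → j < top → x ≐ lift j σ → F x ≡ bit b + j

  classify : ∀ σ → ∃ λ b → σ ↦ b
  classify σ with m≤n⇒m<n∨m≡n (F-bottom-level (level-≐ σ 0<top))
  ... | inj₁ (s≤s Fx₀≤0) = false , λ j<top x≐ →
    trans (level-rigid j<top x≐) (cong (_+ _) (n≤0⇒n≡0 Fx₀≤0))
  ... | inj₂ Fx₀≡1 = true , λ j<top x≐ → trans (level-rigid j<top x≐) (cong (_+ _) Fx₀≡1)

  determined : ∀ {σ j x b} → j < top → x ≐ lift j σ → F x ≡ bit b + j → σ ↦ b
  determined {σ} {j} j<top x≐ Fx with classify σ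
  ... | b′ , σ↦b′ =
    subst (σ ↦_) (bit-injective (+-cancelʳ-≡ j _ _ (trans (sym (σ↦b′ j<top x≐)) Fx))) σ↦b′

  ↦-cong : ∀ {σ τ b} → σ ≗ τ → σ ↦ b → τ ↦ b
  ↦-cong σ≗τ σ↦b j<top x≐ = σ↦b j<top (lift-cong (sym ∘ σ≗τ) x≐)

  not-↦-true : ∀ {σ} → σ ↦ false → (not ∘ σ) ↦ true
  not-↦-true {σ} σ↦false = determined top-1<top y′≐ (top-complement y≐ y′≐ (σ↦false top-1<top y≐))
    where
    y≐  = level-≐ σ top-1<top
    y′≐ = level-≐ (not ∘ σ) top-1<top

  disjoint-↦ : ∀ {σ τ} → Disjoint σ τ → σ ↦ true → τ ↦ true → ⊥
  disjoint-↦ {σ} {τ} σ∩τ σ↦true τ↦true =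
    F-no-repeat no-loop-second adj (σ↦true 0<top x≐) (τ↦true 0<top y≐)
    where
    x≐ = level-≐ σ 0<top
    y≐ = level-≐ τ 0<top
    step : ∀ b c → (T b → T c → ⊥) → bit b + 0 ~ bit c + 0
    step false false _  = loop-0
    step false true  _  = up
    step true  false _  = down
    step true  true  b∩c = ⊥-elim (b∩c tt tt)
    adj = adjacent x≐ y≐ (λ i → step (σ i) (τ i) (σ∩τ i))

  tier : Bool → Bool → ℕ
  tier _ true  = 2
  tier b false = bit b

  module Staircase (σ τ : Pattern k) where

    stair : ℕ → Tuple
    stair j = realise (λ i → tier (σ i) (τ i) + j)

    stair-≐ : ∀ {j} → j ≤ 1 + p → stair j ≐ λ i → tier (σ i) (τ i) + j
    stair-≐ {j} j≤ = realise-≐ (λ i → bound (σ i) (τ i))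
      where
      bound : ∀ b c → tier b c + j ≤ top
      bound _     true  = s≤s (s≤s j≤)
      bound false false = m≤n⇒m≤1+n (m≤n⇒m≤1+n j≤)
      bound true  false = s≤s (m≤n⇒m≤1+n j≤)

    stair-below : Disjoint σ τ → ∀ {j} → j ≤ 1 + p → Adjacent (stair j) (level (suc j) σ)
    stair-below σ∩τ {j} j≤ =
      adjacent (stair-≐ j≤) (level-≐ σ (s≤s (s≤s j≤))) (λ i → step (σ i) (τ i) (σ∩τ i))
      where
      step : ∀ b c → (T b → T c → ⊥) → tier b c + j ~ bit b + suc j
      step false false _   = up
      step true  false _   = up
      step false true  _   = down
      step true  true  b∩c = ⊥-elim (b∩c tt tt)

    stair-top : Adjacent (stair (1 + p)) (level top-1 (σ ∪ τ))
    stair-top = adjacent (stair-≐ ≤-refl) (level-≐ (σ ∪ τ) top-1<top) (λ i → step (σ i) (τ i))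
      where
      step : ∀ b c → tier b c + (1 + p) ~ bit (b ∨ c) + top-1
      step false false = up
      step true  false = up
      step false true  = loop-top
      step true  true  = loop-top

    stair-up : ∀ {j} → suc j ≤ 1 + p → Adjacent (stair j) (stair (suc j))
    stair-up {j} j<1+p = adjacent (stair-≐ (<⇒≤ j<1+p)) (stair-≐ j<1+p) (λ i → step (σ i) (τ i))
      where
      step : ∀ b c → tier b c + j ~ tier b c + suc j
      step _     true  = up
      step false false = up
      step true  false = up

    stair-bottom : Adjacent (stair 0) (level 0 τ)
    stair-bottom = adjacent (stair-≐ z≤n) (level-≐ τ 0<top) (λ i → step (σ i) (τ i))
      where
      step : ∀ b c → tier b c + 0 ~ bit c + 0
      step false false = loop-0
      step true  false = down
      step _     true  = down

  -- The staircase is forced to the top at level 1 + p and descends by at most one per level,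
  -- so at level 0 it still has value 2, next to the bottom level of τ.
  split-↦ : ∀ {σ τ} → Disjoint σ τ → (σ ∪ τ) ↦ true → σ ↦ false → τ ↦ true
  split-↦ {σ} {τ} σ∩τ σ∪τ↦true σ↦false = determined 0<top w≐ Fw≡1
    where
    open Staircase σ τ
    w≐ = level-≐ τ 0<top

    F-stair-top : F (stair (1 + p)) ≡ top
    F-stair-top = F-forced-top (stair-below σ∩τ ≤-refl) (σ↦false top-1<top (level-≐ σ top-1<top))
      (≤-pred (subst (_≤ suc (F (stair (1 + p)))) (σ∪τ↦true top-1<top (level-≐ (σ ∪ τ) top-1<top))
                     (proj₂ (F-close stair-top))))

    F-stair-lower : ∀ d {j} → d + j ≡ 1 + p → 2 + j ≤ F (stair j)
    F-stair-lower zero    refl = ≤-reflexive (sym F-stair-top)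
    F-stair-lower (suc d) {j} d+j≡ = ≤-pred (≤-trans (F-stair-lower d (trans (+-suc d j) d+j≡))
      (proj₂ (F-close (stair-up (subst (suc j ≤_) d+j≡ (s≤s (m≤n+m j d)))))))

    Fw≡1 : F (level 0 τ) ≡ 1
    Fw≡1 = ≤-antisym (F-bottom-level w≐)
      (≤-pred (≤-trans (F-stair-lower (1 + p) (+-identityʳ _)) (proj₁ (F-close stair-bottom))))

  union-↦ : ∀ {σ τ} → Disjoint σ τ → (σ ∪ τ) ↦ true → σ ↦ true ⊎ τ ↦ true
  union-↦ {σ} σ∩τ σ∪τ↦true with classify σ
  ... | true  , σ↦true  = inj₁ σ↦true
  ... | false , σ↦false = inj₂ (split-↦ σ∩τ σ∪τ↦true σ↦false)

  dictator : ∃ λ (m : Fin k) → single (toℕ m) ↦ true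
  dictator = singleton-from-full (_↦ true) ↦-cong empty-↦̸ union-↦ full-↦
    where
    empty-↦̸ : ¬ (λ _ → false) ↦ true
    empty-↦̸ empty↦true =
      1+n≢0 (trans (sym (empty↦true 0<top (λ _ → toℕ-vertex-≤ z≤n))) (F-const z≤n))
    full-↦ : (λ _ → true) ↦ true
    full-↦ = determined 0<top (λ _ → toℕ-vertex-≤ (s≤s z≤n)) (F-const (s≤s z≤n))

  ↦-dictator : ∀ {m} → single (toℕ m) ↦ true → ∀ σ → σ ↦ σ m
  ↦-dictator {m} m↦true σ with σ m in σm | classify σ
  ... | false | false , σ↦false = σ↦false
  ... | true  | true  , σ↦true  = σ↦true
  ... | false | true  , σ↦true  = ⊥-elim (disjoint-↦ (single-disjoint σm) m↦true σ↦true)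
  ... | true  | false , σ↦false =
    ⊥-elim (disjoint-↦ (single-disjoint (cong not σm)) m↦true (not-↦-true σ↦false))

  move : ℕ → Tuple → Tuple
  move c x = realise (λ i → toward c (toℕ (x i)))

  toℕ-move : ∀ c x i → toℕ (move c x i) ≡ toward c (toℕ (x i)) ⊓ top
  toℕ-move c x i = toℕ-vertex _

  move-adjacent : ∀ c x → Adjacent x (move c x)
  move-adjacent c x i =
    subst₂ _~_ (m≤n⇒m⊓n≡m (≤top (x i))) (sym (toℕ-move c x i)) (~-⊓ (~-toward c (toℕ (x i))))

  toward-⊓-up : ∀ {c v w} → v < c → suc v ≡ w → w ≤ top → toward c v ⊓ top ≡ w
  toward-⊓-up v<c refl w≤top = trans (cong (_⊓ top) (toward-below v<c)) (m≤n⇒m⊓n≡m w≤top)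

  toward-⊓-down : ∀ {c v w} → c ≤ v → pred v ≡ w → w ≤ top → toward c v ⊓ top ≡ w
  toward-⊓-down c≤v refl w≤top = trans (cong (_⊓ top) (toward-above c≤v)) (m≤n⇒m⊓n≡m w≤top)

  close-to-move : ∀ c x {w} → F (move c x) ≡ w → Close (F x) w
  close-to-move c x Fmove≡w = subst (Close (F x)) Fmove≡w (F-close (move-adjacent c x))

  module Spread (m : Fin k) (levels : ∀ σ → σ ↦ σ m) where

    Window : ℕ → ℕ → Tuple → Set
    Window a s x = ∀ i → a ≤ toℕ (x i) × toℕ (x i) ≤ s + a

    Projects : ℕ → Set
    Projects s = ∀ {a x} → s + a ≤ top → Window a s x → F x ≡ toℕ (x m)

    two-valued : ∀ {a v} → a ≤ v → v ≤ 1 + a → v ≡ bit ⌊ a <? v ⌋ + a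
    two-valued {a} {v} a≤v v≤1+a with a <? v
    ... | yes a<v = ≤-antisym v≤1+a a<v
    ... | no  a≮v = ≤-antisym (≮⇒≥ a≮v) a≤v

    projects-1 : Projects 1
    projects-1 {a} {x} a<top w = trans (levels σ a<top x≐) (sym (x≐ m))
      where
      σ : Pattern k
      σ i = ⌊ a <? toℕ (x i) ⌋
      x≐ : x ≐ lift a σ
      x≐ i = two-valued (proj₁ (w i)) (proj₂ (w i))

    window-shift-down : ∀ {a s x} → Window (suc a) s x → Window a s (move 0 x)
    window-shift-down {a} {s} {x} w i
      rewrite toℕ-move 0 x i | toward-above {0} {toℕ (x i)} z≤n
            | m≤n⇒m⊓n≡m (≤-trans pred[n]≤n (≤top (x i))) =
      pred-mono-≤ (proj₁ (w i)) , pred-mono-≤ (subst (toℕ (x i) ≤_) (+-suc s a) (proj₂ (w i)))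

    window-shift-up : ∀ {a s x} → suc (s + a) ≤ top → Window a s x →
                      Window (suc a) s (move (suc top) x)
    window-shift-up {a} {s} {x} bound w i
      rewrite toℕ-move (suc top) x i | toward-below (s≤s (≤top (x i)))
            | m≤n⇒m⊓n≡m (≤-trans (s≤s (proj₂ (w i))) bound) =
      s≤s (proj₁ (w i)) , subst (suc (toℕ (x i)) ≤_) (sym (+-suc s a)) (s≤s (proj₂ (w i)))

    module Step (r : ℕ) (ih : Projects (suc r)) where

      window-narrow : ∀ {a c v} → 2 + r + a ≤ top → a ≤ pred c → c ≤ suc r + a →
                      a ≤ v × v ≤ 2 + r + a → a ≤ toward c v ⊓ top × toward c v ⊓ top ≤ suc r + a
      window-narrow {a} {c} {v} bound a≤c-1 c≤ (a≤v , v≤) with v <? c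
      ... | yes v<c = ⊓-glb (m≤n⇒m≤1+n a≤v) (≤-trans (m≤n+m a (2 + r)) bound)
                    , ≤-trans (m⊓n≤m _ top) (≤-trans v<c c≤)
      ... | no  v≮c = ⊓-glb (≤-trans a≤c-1 (pred-mono-≤ (≮⇒≥ v≮c)))
                            (≤-trans (m≤n+m a (2 + r)) bound)
                    , ≤-trans (m⊓n≤m _ top) (pred-mono-≤ v≤)

      -- The alternative 2 + r + a ≡ top admits thresholds beyond the path, clamped by `vertex`.
      window-raise : ∀ {a c v} → 2 + r + a ≤ top → suc r + a < c → c ≤ 2 + r + a ⊎ 2 + r + a ≡ top →
                     a ≤ v × v ≤ 2 + r + a → suc a ≤ toward c v ⊓ top × toward c v ⊓ top ≤ 2 + r + a
      window-raise {a} {c} {v} bound c-low c-high (a≤v , v≤) with v <? c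
      ... | yes v<c = ⊓-glb (s≤s a≤v) (≤-trans (s≤s (m≤n+m a (suc r))) bound) , upper c-high
        where
        upper : c ≤ 2 + r + a ⊎ 2 + r + a ≡ top → suc v ⊓ top ≤ 2 + r + a
        upper (inj₁ c≤) = ≤-trans (m⊓n≤m _ top) (≤-trans v<c c≤)
        upper (inj₂ max≡top) = ≤-trans (m⊓n≤n _ top) (≤-reflexive (sym max≡top))
      ... | no  v≮c = ⊓-glb (≤-trans (s≤s (m≤n+m a r)) (pred-mono-≤ (≤-trans c-low (≮⇒≥ v≮c))))
                            (≤-trans (s≤s (m≤n+m a (suc r))) bound)
                    , ≤-trans (m⊓n≤m _ top) (≤-trans (pred-mono-≤ v≤) (n≤1+n _))

      F-move : ∀ c {a x w} → 2 + r + a ≤ top → Window a (2 + r) x → a ≤ pred c →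
               c ≤ 2 + r + a ⊎ 2 + r + a ≡ top → toward c (toℕ (x m)) ⊓ top ≡ w → F (move c x) ≡ w
      F-move c {a} {x} bound w a≤c-1 c-high value with c ≤? suc r + a
      ... | yes c≤ = trans (ih (≤-trans (n≤1+n _) bound) narrow) (trans (toℕ-move c x m) value)
        where
        narrow : Window a (suc r) (move c x)
        narrow i rewrite toℕ-move c x i = window-narrow bound a≤c-1 c≤ (w i)
      ... | no  c≰ = trans (ih (subst (_≤ top) (sym (+-suc (suc r) a)) bound) raised)
                           (trans (toℕ-move c x m) value)
        where
        raised : Window (suc a) (suc r) (move c x)
        raised i rewrite toℕ-move c x i | +-suc (suc r) a = window-raise bound (≰⇒> c≰) c-high (w i)

      at-bottom : ∀ {x} → 2 + r + 0 ≤ top → Window 0 (2 + r) x → toℕ (x m) ≡ 0 → F x ≡ 0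
      at-bottom {x} bound w xm≡0 =
        F-forced-bottom (move-adjacent 1 x) F-up (proj₁ (close-to-move 0 x F-down))
        where
        F-down : F (move 0 x) ≡ 0
        F-down = F-move 0 bound w z≤n (inj₁ z≤n)
          (toward-⊓-down {v = toℕ (x m)} z≤n (cong pred xm≡0) z≤n)
        F-up : F (move 1 x) ≡ 1
        F-up = F-move 1 bound w z≤n (inj₁ (s≤s z≤n))
          (toward-⊓-up (subst (_< 1) (sym xm≡0) z<s) (cong suc xm≡0) (s≤s z≤n))

      at-min : ∀ a {x} → 2 + r + a ≤ top → Window a (2 + r) x → toℕ (x m) ≡ a → F x ≡ a
      at-min zero            = at-bottom
      at-min (suc a) {x} bound w xm≡1+a =
        ≤-antisym (proj₁ (close-to-move 0 x F-down)) (≤-pred (proj₂ (close-to-move (2 + a) x F-up)))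
        where
        2+a≤max : 2 + a ≤ 2 + r + suc a
        2+a≤max = s≤s (s≤s (≤-trans (n≤1+n a) (m≤n+m (suc a) r)))
        F-down : F (move 0 x) ≡ a
        F-down = at-min a (≤-trans (+-monoʳ-≤ (2 + r) (n≤1+n a)) bound) (window-shift-down w)
          (trans (toℕ-move 0 x m) (toward-⊓-down {v = toℕ (x m)} z≤n (cong pred xm≡1+a)
                                    (≤-trans (n≤1+n a) (≤-trans (<⇒≤ 2+a≤max) bound))))
        F-up : F (move (2 + a) x) ≡ 2 + a
        F-up = F-move (2 + a) bound w ≤-refl (inj₁ 2+a≤max)
          (toward-⊓-up (subst (_< 2 + a) (sym xm≡1+a) ≤-refl) (cong suc xm≡1+a)
                       (≤-trans 2+a≤max bound))

      at-top : ∀ {a x} → 2 + r + a ≡ top → Window a (2 + r) x → toℕ (x m) ≡ top → F x ≡ top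
      at-top {a} {x} max≡top w xm≡top =
        F-forced-top (move-adjacent top x) F-down (≤-pred (proj₂ (close-to-move (suc top) x F-up)))
        where
        bound = ≤-reflexive max≡top
        F-up : F (move (suc top) x) ≡ top
        F-up = F-move (suc top) bound w (≤-trans (m≤n+m a (2 + r)) bound) (inj₂ max≡top)
          (trans (cong (_⊓ top) (toward-below (s≤s (≤top (x m)))))
                 (m≥n⇒m⊓n≡n (subst (top ≤_) (cong suc (sym xm≡top)) (n≤1+n top))))
        F-down : F (move top x) ≡ top-1
        F-down = F-move top bound w (subst (a ≤_) (cong pred max≡top) (m≤n+m a (suc r)))
          (inj₁ (≤-reflexive (sym max≡top)))
          (toward-⊓-down (≤-reflexive (sym xm≡top)) (cong pred xm≡top) (n≤1+n top-1))

      at-max : ∀ e {a x} → e + (2 + r + a) ≡ top → Window a (2 + r) x →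
               toℕ (x m) ≡ 2 + r + a → F x ≡ 2 + r + a
      at-max zero    max≡top w xm≡max =
        trans (at-top max≡top w (trans xm≡max max≡top)) (sym max≡top)
      at-max (suc e) {a} {x} e+max≡top w xm≡max =
        ≤-antisym (proj₁ (close-to-move (2 + r + a) x F-down))
                  (≤-pred (subst (_≤ suc (F x)) (+-suc (2 + r) a)
                                 (proj₂ (close-to-move (suc top) x F-up))))
        where
        max<top : suc (2 + r + a) ≤ top
        max<top = subst (suc (2 + r + a) ≤_) e+max≡top (s≤s (m≤n+m _ e))
        bound = <⇒≤ max<top
        F-up : F (move (suc top) x) ≡ 2 + r + suc a
        F-up = at-max e (trans (cong (e +_) (+-suc (2 + r) a)) (trans (+-suc e _) e+max≡top))
          (window-shift-up max<top w)
          (trans (toℕ-move (suc top) x m)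
                 (toward-⊓-up (s≤s (≤top (x m))) (trans (cong suc xm≡max) (sym (+-suc (2 + r) a)))
                              (subst (_≤ top) (sym (+-suc (2 + r) a)) max<top)))
        F-down : F (move (2 + r + a) x) ≡ suc r + a
        F-down = F-move (2 + r + a) bound w (m≤n+m a (suc r)) (inj₁ ≤-refl)
          (toward-⊓-down (≤-reflexive (sym xm≡max)) (cong pred xm≡max) (≤-trans (n≤1+n _) bound))

      interior : ∀ {a x} → 2 + r + a ≤ top → Window a (2 + r) x →
                 a < toℕ (x m) → toℕ (x m) < 2 + r + a → F x ≡ toℕ (x m)
      interior {a} {x} bound w a<v v<max =
        ≤-antisym upper (≤-pred (proj₂ (close-to-move (suc v) x F-up)))
        where
        v = toℕ (x m)
        F-up : F (move (suc v) x) ≡ suc v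
        F-up = F-move (suc v) bound w (<⇒≤ a<v) (inj₁ v<max)
          (toward-⊓-up (n<1+n v) refl (≤-trans v<max bound))
        F-down : F (move v x) ≡ pred v
        F-down = F-move v bound w (<⇒≤pred a<v) (inj₁ (<⇒≤ v<max))
          (toward-⊓-down {v} ≤-refl refl (≤-trans pred[n]≤n (≤top (x m))))
        upper : F x ≤ v
        upper = subst (F x ≤_) (suc-pred v {{>-nonZero (≤-<-trans z≤n a<v)}})
                      (proj₁ (close-to-move v x F-down))

      projects-wider : Projects (2 + r)
      projects-wider {a} {x} bound w with m≤n⇒m<n∨m≡n (proj₁ (w m))
      ... | inj₂ a≡v = trans (at-min a bound w (sym a≡v)) a≡v
      ... | inj₁ a<v with m≤n⇒m<n∨m≡n (proj₂ (w m))
      ...   | inj₁ v<max = interior bound w a<v v<max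
      ...   | inj₂ v≡max = trans (at-max (top ∸ (2 + r + a)) (m∸n+n≡m bound) w v≡max) (sym v≡max)

    projects : ∀ r → Projects (suc r)
    projects zero    = projects-1
    projects (suc r) = Step.projects-wider r (projects r)

    projection : ∀ x → f x ≡ x m
    projection x = toℕ-injective (projects (2 + p) {0} (≤-reflexive (+-identityʳ top))
      (λ i → z≤n , subst (toℕ (x i) ≤_) (sym (+-identityʳ top)) (≤top (x i))))

  is-projection : IsProjection k β f
  is-projection with dictator
  ... | m , m↦true = m , Spread.projection m (↦-dictator m↦true)

lookup-++-right : ∀ {A : Set} (xs : List A) {ys} (i : Fin (length (xs ++ ys)))
                  (j : Fin (length ys)) → toℕ i ≡ toℕ j + length xs →
                  lookup (xs ++ ys) i ≡ lookup ys j
lookup-++-right []       {ys} i        j i≡j =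
  cong (lookup ys) (toℕ-injective (trans i≡j (+-identityʳ _)))
lookup-++-right (_ ∷ xs)      fzero    j 0≡  =
  ⊥-elim (0≢1+n (trans 0≡ (+-suc (toℕ j) (length xs))))
lookup-++-right (_ ∷ xs)      (fsuc i) j i≡  =
  lookup-++-right xs i j (suc-injective (trans i≡ (+-suc _ _)))

length-word : ∀ α → length (word α) ≡ 4 + length α
length-word α = cong (2 +_) (trans (length-++ α) (+-comm (length α) 2))

lemma5 : (α : List Bool) (k : ℕ) (f : Op k (word α)) →
         IsPolymorphism k (word α) f → IsIdempotent k (word α) f →
         IsProjection k (word α) f
lemma5 α = LoopedEnds.is-projection (word α) (length α) (length-word α) first second penult last
  where
  first : ∀ u → toℕ u ≡ 0 → T (lookup (word α) u)
  first fzero _ = tt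

  second : ∀ u → toℕ u ≡ 1 → ¬ T (lookup (word α) u)
  second (fsuc fzero) _ ()

  penult : ∀ u → toℕ u ≡ 2 + length α → ¬ T (lookup (word α) u)
  penult (fsuc (fsuc u)) u≡ = subst T (lookup-++-right α u fzero (suc-injective (suc-injective u≡)))

  last : ∀ u → toℕ u ≡ 3 + length α → T (lookup (word α) u)
  last (fsuc (fsuc u)) u≡ =
    subst T (sym (lookup-++-right α u (fsuc fzero) (suc-injective (suc-injective u≡)))) tt
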